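{- Let $k\ge 4$ and $s\ge 0$ be integers and let $G$ be a $k$-contraction-critical graph. Let $x\in V(G)$ be a vertex of degree $k+s$ with $\alpha(N(x))=s+2$, and let $S\subset N(x)$ with $|S|=s+2$ be any independent set. Suppose $N(x)\setminus S$ does not induce a clique. Let $m\ge 1$ and $r_1,\dots,r_m\ge 1$ be integers with $r_1+r_2+\dots+r_m+m\le k-2$, and let $a_1,\dots,a_m,b_{11},\dots,b_{1r_1},\dots,b_{m1},\dots,b_{mr_m}$ be pairwise distinct vertices of $N(x)\setminus S$ such that for each $i\in\{1,\dots,m\}$ and each $j\in\{1,\dots,r_i\}$, $a_i$ and $b_{ij}$ are non-adjacent in $G$. Then for each $i\in\{1,\dots,m\}$ there exist paths $P_{i1},\dots,P_{ir_i}$ in $G$ such that each $P_{ij}$ has ends $a_i$ and $b_{ij}$ and all its internal vertices lie in $V(G)\setminus N[x]$. Moreover, for any $1\le i<\ell\le m$, the paths $P_{i1},\dots,P_{ir_i}$ are vertex-disjoint from the paths $P_{\ell 1},\dots,P_{\ell r_\ell}$.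
   Context: All graphs are finite and simple. A graph $G$ is $k$-contraction-critical if $\chi(G)=k$ and every proper minor of $G$ is $(k-1)$-colorable (a minor is obtained from a subgraph by contracting edges). $N(v)$ is the neighborhood of $v$ (also used for the subgraph it induces), $N[v]=N(v)\cup\{v\}$, and $\alpha(N(x))$ is the independence number of the subgraph induced by $N(x)$. -}

module Defs where

open import Data.Nat using (ℕ; zero; suc; _+_; _∸_; _≤_; _<_; _<ᵇ_)
open import Data.Bool using (Bool; true; false; _∧_)
open import Data.Fin using (Fin; toℕ)
open import Data.Fin.Subset using (Subset; _∈_; _∉_; ∣_∣)
open import Data.Vec using (tabulate; sum)
open import Data.List using (List; []; _∷_)
open import Data.List.Relation.Unary.All using (All)
open import Data.List.Relation.Unary.Unique.Propositional using (Unique)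
open import Data.Maybe using (Maybe; just; nothing)
open import Data.Product using (Σ; ∃; ∃-syntax; _×_; _,_)
open import Relation.Binary.PropositionalEquality using (_≡_; _≢_)
open import Relation.Nullary using (¬_)

record Graph (n : ℕ) : Set where
  field
    adj    : Fin n → Fin n → Bool
    sym    : ∀ u v → adj u v ≡ adj v u
    irrefl : ∀ v → adj v v ≡ false
open Graph public

module _ {n : ℕ} (G : Graph n) where

  nbhd : Fin n → Subset n
  nbhd x = tabulate (adj G x)

  degree : Fin n → ℕ
  degree x = ∣ nbhd x ∣

  numEdges : ℕ
  numEdges = sum (tabulate λ u → ∣ tabulate (λ v → adj G u v ∧ (toℕ u <ᵇ toℕ v)) ∣)

  Colorable : ℕ → Set
  Colorable k = Σ (Fin n → Fin k) λ c → ∀ u v → adj G u v ≡ true → c u ≢ c v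

  ChromaticNumber : ℕ → Set
  ChromaticNumber k = Colorable k × ¬ Colorable (k ∸ 1)

  data Walk : Fin n → Fin n → Set where
    [] : ∀ {u} → Walk u u
    _∷_ : ∀ {u w v} → adj G u w ≡ true → Walk w v → Walk u v

  verts : ∀ {u v} → Walk u v → List (Fin n)
  verts {u} [] = u ∷ []
  verts {u} (_ ∷ p) = u ∷ verts p

  vertsButLast : ∀ {u v} → Walk u v → List (Fin n)
  vertsButLast [] = []
  vertsButLast {u} (_ ∷ p) = u ∷ vertsButLast p

  interior : ∀ {u v} → Walk u v → List (Fin n)
  interior [] = []
  interior (_ ∷ p) = vertsButLast p

  IsPath : ∀ {u v} → Walk u v → Set
  IsPath p = Unique (verts p)

  Independent : Subset n → Set
  Independent S = ∀ u v → u ∈ S → v ∈ S → adj G u v ≡ false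

  IndepNumberNbhd : Fin n → ℕ → Set
  IndepNumberNbhd x a =
    (∃[ S ] (∀ v → v ∈ S → v ∈ nbhd x) × Independent S × ∣ S ∣ ≡ a)
    × (∀ S → (∀ v → v ∈ S → v ∈ nbhd x) → Independent S → ∣ S ∣ ≤ a)

-- H is a minor of G: a minor model given by disjoint non-empty connected
-- branch sets f⁻¹(just a) ⊆ V(G), one per vertex a of H, such that every edge
-- ab of H is realised by an edge of G between the branch sets of a and b.
record IsMinor {m n : ℕ} (H : Graph m) (G : Graph n) : Set where
  field
    branch    : Fin n → Maybe (Fin m)
    nonempty  : ∀ a → ∃[ v ] branch v ≡ just a
    connected : ∀ a u v → branch u ≡ just a → branch v ≡ just a →
                Σ (Walk G u v) λ p → All (λ w → branch w ≡ just a) (verts G p)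
    edges     : ∀ a b → adj H a b ≡ true →
                ∃[ u ] ∃[ v ] branch u ≡ just a × branch v ≡ just b × adj G u v ≡ true

-- proper minor: a minor with |V(H)| + |E(H)| < |V(G)| + |E(G)|
-- (i.e. a minor not isomorphic to G)
IsProperMinor : {m n : ℕ} → Graph m → Graph n → Set
IsProperMinor {m} {n} H G = IsMinor H G × (m + numEdges H < n + numEdges G)

ContractionCritical : {n : ℕ} → ℕ → Graph n → Set
ContractionCritical {n} k G =
  ChromaticNumber G k ×
  (∀ m (H : Graph m) → IsProperMinor H G → Colorable H (k ∸ 1))

-- Write k = d + 2.  Contracting the star S ∪ {x} yields a proper minor of G
-- (fewer vertices, no new edges), hence a (d+1)-colouring c of G - x that is
-- constant on S.  Rainbow lemma: any proper (d+1)-colouring of G - x that is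
-- constant on S gives the d vertices of N(x) ∖ S pairwise distinct colours,
-- different from the colour of S, for otherwise N(x) would miss a colour and
-- x could be coloured, contradicting χ(G) = k.  For distinct a, b ∈ N(x) ∖ S
-- the (c a, c b)-Kempe chain of G - x through a therefore contains b (else
-- exchanging its two colours breaks the rainbow lemma), giving an a-b path of
-- vertices coloured c a or c b.  By the rainbow lemma its interior avoids
-- N[x], and chains for disjoint pairs use disjoint colour pairs.
module Submission where

open import Defs renaming (sym to adj-sym)
open import Data.Nat using (ℕ; zero; suc; _+_; _∸_; _≤_; _<_; z≤n; s≤s; _<ᵇ_)
import Data.Nat.Properties as ℕP
open import Data.Bool as Bool using (Bool; true; false; _∧_)
open import Data.Bool.Properties using (∧-conicalˡ; ∧-conicalʳ; T-≡)
open import Function using (id; _∘_; case_of_; Equivalence; mk⇔)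
open import Data.Maybe using (just)
open import Data.Maybe.Properties using (just-injective)
open import Data.Sum using (_⊎_; inj₁; inj₂)
open import Data.Fin as F using (Fin; toℕ)
import Data.Fin.Properties as FP
open import Data.Fin.Subset as Sub using (Subset; _∈_; _∉_; ∁; _∩_; ∣_∣)
import Data.Fin.Subset.Properties as SubP
open import Data.Vec using (tabulate; sum; []; _∷_; here; there)
import Data.Vec.Properties as VP
open import Data.List as L using (List; []; _∷_; _++_; length; map; lookup)
import Data.List.Properties as LP
open import Data.List.Relation.Unary.Any as Any using (Any; here; there; index)
open import Data.List.Relation.Unary.Any.Properties using (lookup-index)
open import Data.List.Relation.Unary.All as All using (All; []; _∷_)
open import Data.List.Relation.Unary.AllPairs using ([]; _∷_)
open import Data.List.Relation.Unary.Unique.Propositional using (Unique)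
import Data.List.Relation.Unary.Unique.Propositional.Properties as UniqueP
open import Data.List.Membership.Propositional using () renaming (_∈_ to _∈ₗ_)
import Data.List.Membership.DecPropositional as DecMembership
open import Data.List.Relation.Binary.Subset.Propositional using (_⊆_)
open import Data.List.Membership.Propositional.Properties
  using (∈-lookup; ∈-allFin; ∈-filter⁺; ∈-map⁺; ∈-map⁻; ∈-++⁺ˡ; ∈-++⁺ʳ; ∈-++⁻)
open import Data.Product using (Σ; ∃-syntax; _×_; _,_; proj₁; proj₂)
open import Data.Empty using (⊥; ⊥-elim)
open import Relation.Binary.PropositionalEquality
open import Relation.Binary using (tri<; tri≈; tri>)
open import Relation.Nullary using (¬_; Dec; yes; no)
open import Relation.Nullary.Decidable using (does; ¬?; _×-dec_; _⊎-dec_; dec-true; dec-false; does-⇔)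
open import Relation.Unary using (Decidable)

lookup-injective : ∀ {A : Set} {xs : List A} → Unique xs →
  (i j : Fin (length xs)) → lookup xs i ≡ lookup xs j → i ≡ j
lookup-injective (_ ∷ _) F.zero F.zero _ = refl
lookup-injective (x∉ ∷ _) F.zero (F.suc j) e = ⊥-elim (All.lookup x∉ (∈-lookup j) e)
lookup-injective (x∉ ∷ _) (F.suc i) F.zero e = ⊥-elim (All.lookup x∉ (∈-lookup i) (sym e))
lookup-injective (_ ∷ u) (F.suc i) (F.suc j) e = cong F.suc (lookup-injective u i j e)

length-≤-injection : ∀ {A B : Set} {xs : List A} {ys : List B} → Unique xs →
  (f : ∀ a → a ∈ₗ xs → B) → (∀ a a∈ → f a a∈ ∈ₗ ys) →
  (∀ a a′ a∈ a′∈ → f a a∈ ≡ f a′ a′∈ → a ≡ a′) → length xs ≤ length ys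
length-≤-injection {xs = xs} {ys} uniq f f∈ f-inj with length xs ℕP.≤? length ys
... | yes xs≤ys = xs≤ys
... | no xs≰ys
  with i , j , i<j , same ← FP.pigeonhole (ℕP.≰⇒> xs≰ys) (λ i → index (f∈ _ (∈-lookup i)))
  = ⊥-elim (FP.<⇒≢ i<j (lookup-injective uniq i j (f-inj _ _ _ _ (begin
      f _ (∈-lookup i)                        ≡⟨ lookup-index (f∈ _ (∈-lookup i)) ⟩
      lookup ys (index (f∈ _ (∈-lookup i)))  ≡⟨ cong (lookup ys) same ⟩
      lookup ys (index (f∈ _ (∈-lookup j)))  ≡⟨ lookup-index (f∈ _ (∈-lookup j)) ⟨
      f _ (∈-lookup j)                        ∎))))
  where open ≡-Reasoning

length-≤-⊆ : ∀ {A : Set} {xs ys : List A} → Unique xs →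
  (∀ {a} → a ∈ₗ xs → a ∈ₗ ys) → length xs ≤ length ys
length-≤-⊆ uniq xs⊆ys =
  length-≤-injection uniq (λ a _ → a) (λ _ a∈ → xs⊆ys a∈) (λ _ _ _ _ e → e)

elements : ∀ {n} → Subset n → List (Fin n)
elements [] = []
elements (true ∷ p) = F.zero ∷ map F.suc (elements p)
elements (false ∷ p) = map F.suc (elements p)

∈-elements⁺ : ∀ {n} {p : Subset n} {v} → v ∈ p → v ∈ₗ elements p
∈-elements⁺ {p = true ∷ p} here = here refl
∈-elements⁺ {p = true ∷ p} (there v∈p) = there (∈-map⁺ F.suc (∈-elements⁺ v∈p))
∈-elements⁺ {p = false ∷ p} (there v∈p) = ∈-map⁺ F.suc (∈-elements⁺ v∈p)

∈-elements⁻ : ∀ {n} {p : Subset n} {v} → v ∈ₗ elements p → v ∈ p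
∈-elements⁻ {p = true ∷ p} (here refl) = here
∈-elements⁻ {p = true ∷ p} (there v∈) with ∈-map⁻ F.suc v∈
... | _ , w∈ , refl = there (∈-elements⁻ w∈)
∈-elements⁻ {p = false ∷ p} v∈ with ∈-map⁻ F.suc v∈
... | _ , w∈ , refl = there (∈-elements⁻ w∈)

length-elements : ∀ {n} (p : Subset n) → length (elements p) ≡ ∣ p ∣
length-elements [] = refl
length-elements (true ∷ p) = cong suc (trans (LP.length-map F.suc (elements p)) (length-elements p))
length-elements (false ∷ p) = trans (LP.length-map F.suc (elements p)) (length-elements p)

elements-unique : ∀ {n} (p : Subset n) → Unique (elements p)
elements-unique [] = []
elements-unique (true ∷ p) =
  All.tabulate zero∉ ∷ UniqueP.map⁺ FP.suc-injective (elements-unique p)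
  where
  zero∉ : ∀ {v} → v ∈ₗ map F.suc (elements p) → F.zero ≢ v
  zero∉ v∈ with ∈-map⁻ F.suc v∈
  ... | _ , _ , refl = λ ()
elements-unique (false ∷ p) = UniqueP.map⁺ FP.suc-injective (elements-unique p)

∣p∣≡∣q∣+∣p∖q∣ : ∀ {n} (P Q : Subset n) → Q Sub.⊆ P → ∣ P ∣ ≡ ∣ Q ∣ + ∣ P ∩ ∁ Q ∣
∣p∣≡∣q∣+∣p∖q∣ [] [] _ = refl
∣p∣≡∣q∣+∣p∖q∣ (p ∷ P) (q ∷ Q) Q⊆P
  with ∣p∣≡∣q∣+∣p∖q∣ P Q (λ v∈Q → drop-there (Q⊆P (there v∈Q)))
  where
  drop-there : ∀ {n b} {v : Fin n} {P} → F.suc v ∈ (b ∷ P) → v ∈ P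
  drop-there (there v∈P) = v∈P
∣p∣≡∣q∣+∣p∖q∣ (true ∷ P) (true ∷ Q) _ | ih = cong suc ih
∣p∣≡∣q∣+∣p∖q∣ (true ∷ P) (false ∷ Q) _ | ih = trans (cong suc ih) (sym (ℕP.+-suc _ _))
∣p∣≡∣q∣+∣p∖q∣ (false ∷ P) (true ∷ Q) Q⊆P | _ with () ← Q⊆P here
∣p∣≡∣q∣+∣p∖q∣ (false ∷ P) (false ∷ Q) _ | ih = ih

∈-tabulate⁻ : ∀ {n} {g : Fin n → Bool} {v} → v ∈ tabulate g → g v ≡ true
∈-tabulate⁻ {g = g} {v} v∈ = trans (sym (VP.lookup∘tabulate g v)) (VP.[]=⇒lookup v∈)

∈-tabulate⁺ : ∀ {n} {g : Fin n → Bool} {v} → g v ≡ true → v ∈ tabulate g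
∈-tabulate⁺ {g = g} {v} gv = VP.lookup⇒[]= v _ (trans (VP.lookup∘tabulate g v) gv)

concatFin : ∀ {A : Set} n → (Fin n → List A) → List A
concatFin zero f = []
concatFin (suc n) f = f F.zero ++ concatFin n (f ∘ F.suc)

length-concatFin : ∀ {A : Set} n (f : Fin n → List A) →
  length (concatFin n f) ≡ sum (tabulate (length ∘ f))
length-concatFin zero f = refl
length-concatFin (suc n) f =
  trans (LP.length-++ (f F.zero)) (cong (length (f F.zero) +_) (length-concatFin n (f ∘ F.suc)))

∈-concatFin⁻ : ∀ {A : Set} n (f : Fin n → List A) {z} → z ∈ₗ concatFin n f → ∃[ u ] z ∈ₗ f u
∈-concatFin⁻ (suc n) f z∈ with ∈-++⁻ (f F.zero) z∈
... | inj₁ z∈f0 = F.zero , z∈f0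
... | inj₂ z∈rest with u , z∈fu ← ∈-concatFin⁻ n (f ∘ F.suc) z∈rest = F.suc u , z∈fu

∈-concatFin⁺ : ∀ {A : Set} n (f : Fin n → List A) {z} u → z ∈ₗ f u → z ∈ₗ concatFin n f
∈-concatFin⁺ (suc n) f F.zero z∈ = ∈-++⁺ˡ z∈
∈-concatFin⁺ (suc n) f (F.suc u) z∈ = ∈-++⁺ʳ (f F.zero) (∈-concatFin⁺ n (f ∘ F.suc) u z∈)

concatFin-unique : ∀ {A : Set} n (f : Fin n → List A) → (∀ u → Unique (f u)) →
  (∀ u u′ {z} → z ∈ₗ f u → z ∈ₗ f u′ → u ≡ u′) → Unique (concatFin n f)
concatFin-unique zero f _ _ = []
concatFin-unique (suc n) f uniq disj =
  UniqueP.++⁺ (uniq F.zero)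
    (concatFin-unique n (f ∘ F.suc) (uniq ∘ F.suc)
      (λ u u′ z∈ z∈′ → FP.suc-injective (disj _ _ z∈ z∈′)))
    (λ (z∈f0 , z∈rest) → zero∉rest z∈f0 z∈rest)
  where
  zero∉rest : ∀ {z} → z ∈ₗ f F.zero → z ∈ₗ concatFin n (f ∘ F.suc) → ⊥
  zero∉rest z∈f0 z∈rest with u , z∈fu ← ∈-concatFin⁻ n (f ∘ F.suc) z∈rest
    with () ← disj _ _ z∈f0 z∈fu

module EdgeList {n : ℕ} (G : Graph n) where

  laterNeighbours : Fin n → Subset n
  laterNeighbours u = tabulate (λ v → adj G u v ∧ (toℕ u <ᵇ toℕ v))

  row : Fin n → List (Fin n × Fin n)
  row u = map (u ,_) (elements (laterNeighbours u))

  edgeList : List (Fin n × Fin n)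
  edgeList = concatFin n row

  numEdges≡length : numEdges G ≡ length edgeList
  numEdges≡length = sym (trans (length-concatFin n row) (cong sum (VP.tabulate-cong λ u →
    trans (LP.length-map (u ,_) (elements (laterNeighbours u))) (length-elements (laterNeighbours u)))))

  ∈-edgeList⁻ : ∀ {z} → z ∈ₗ edgeList → ∃[ u ] ∃[ v ] z ≡ (u , v) × adj G u v ≡ true × u F.< v
  ∈-edgeList⁻ z∈ with u , z∈row ← ∈-concatFin⁻ n row z∈
    with v , v∈ , refl ← ∈-map⁻ (u ,_) z∈row
    = let both = ∈-tabulate⁻ (∈-elements⁻ v∈) in
      u , v , refl , ∧-conicalˡ _ _ both , ℕP.<ᵇ⇒< _ _ (Equivalence.from T-≡ (∧-conicalʳ _ _ both))

  ∈-edgeList⁺ : ∀ {u v} → adj G u v ≡ true → u F.< v → (u , v) ∈ₗ edgeList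
  ∈-edgeList⁺ {u} {v} adj-uv u<v = ∈-concatFin⁺ n row u (∈-map⁺ (u ,_) (∈-elements⁺
    (∈-tabulate⁺ {g = λ w → adj G u w ∧ (toℕ u <ᵇ toℕ w)}
      (cong₂ _∧_ adj-uv (Equivalence.to T-≡ (ℕP.<⇒<ᵇ u<v))))))

  edgeList-unique : Unique edgeList
  edgeList-unique = concatFin-unique n row
    (λ u → UniqueP.map⁺ (cong proj₂) (elements-unique (laterNeighbours u)))
    (λ u u′ z∈ z∈′ → trans (sym (source z∈)) (source z∈′))
    where
    source : ∀ {u z} → z ∈ₗ row u → proj₁ z ≡ u
    source z∈ with _ , _ , refl ← ∈-map⁻ _ z∈ = refl

-- If every edge of H is the image of an edge of G under a vertex map φ, then H
-- has at most as many edges as G: sending each edge of H to one of its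
-- preimages is injective on edges (both are listed as increasing pairs).
numEdges-≤-image : ∀ {m n} (H : Graph m) (G : Graph n) (φ : Fin n → Fin m) →
  (∀ i j → adj H i j ≡ true → ∃[ p ] ∃[ q ] φ p ≡ i × φ q ≡ j × adj G p q ≡ true) →
  numEdges H ≤ numEdges G
numEdges-≤-image {m} {n} H G φ lifts =
  subst₂ _≤_ (sym H.numEdges≡length) (sym G.numEdges≡length)
    (length-≤-injection H.edgeList-unique
      (λ _ z∈ → proj₁ (lift z∈)) (λ _ z∈ → proj₁ (proj₂ (lift z∈)))
      (λ _ _ z∈ z′∈ same → covers-unique (increasing z∈) (increasing z′∈)
        (proj₂ (proj₂ (lift z∈))) (subst (Covers _) (sym same) (proj₂ (proj₂ (lift z′∈))))))
  where
  module H = EdgeList H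
  module G = EdgeList G

  Covers : Fin m × Fin m → Fin n × Fin n → Set
  Covers z (p , q) = (φ p , φ q) ≡ z ⊎ (φ q , φ p) ≡ z

  increasing : ∀ {z} → z ∈ₗ H.edgeList → proj₁ z F.< proj₂ z
  increasing z∈ with _ , _ , refl , _ , i<j ← H.∈-edgeList⁻ z∈ = i<j

  lift : ∀ {z} → z ∈ₗ H.edgeList → Σ (Fin n × Fin n) λ w → w ∈ₗ G.edgeList × Covers z w
  lift z∈ with i , j , refl , adj-ij , i<j ← H.∈-edgeList⁻ z∈
    with p , q , refl , refl , adj-pq ← lifts i j adj-ij
    with FP.<-cmp p q
  ... | tri< p<q _ _ = (p , q) , G.∈-edgeList⁺ adj-pq p<q , inj₁ refl
  ... | tri≈ _ refl _ = ⊥-elim (FP.<-irrefl refl i<j)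
  ... | tri> _ _ q<p = (q , p) , G.∈-edgeList⁺ (trans (adj-sym G q p) adj-pq) q<p , inj₂ refl

  covers-unique : ∀ {z z′ w} → proj₁ z F.< proj₂ z → proj₁ z′ F.< proj₂ z′ →
    Covers z w → Covers z′ w → z ≡ z′
  covers-unique _ _ (inj₁ refl) (inj₁ refl) = refl
  covers-unique _ _ (inj₂ refl) (inj₂ refl) = refl
  covers-unique z< z′< (inj₁ refl) (inj₂ refl) = ⊥-elim (FP.<-asym z< z′<)
  covers-unique z< z′< (inj₂ refl) (inj₁ refl) = ⊥-elim (FP.<-asym z< z′<)

module Walks {n : ℕ} (G : Graph n) where

  open DecMembership (FP._≟_ {n}) using (_∈?_)

  first∈verts : ∀ {u v} (p : Walk G u v) → u ∈ₗ verts G p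
  first∈verts [] = here refl
  first∈verts (_ ∷ _) = here refl

  last∈verts : ∀ {u v} (p : Walk G u v) → v ∈ₗ verts G p
  last∈verts [] = here refl
  last∈verts (_ ∷ p) = there (last∈verts p)

  vertsButLast⊆verts : ∀ {u v} (p : Walk G u v) → vertsButLast G p ⊆ verts G p
  vertsButLast⊆verts (_ ∷ p) (here refl) = here refl
  vertsButLast⊆verts (_ ∷ p) (there z∈) = there (vertsButLast⊆verts p z∈)

  interior⊆verts : ∀ {u v} (p : Walk G u v) → interior G p ⊆ verts G p
  interior⊆verts (_ ∷ p) z∈ = there (vertsButLast⊆verts p z∈)

  ∉-vertsButLast : ∀ {u v z} (p : Walk G u v) → IsPath G p → z ∈ₗ vertsButLast G p → z ≢ v
  ∉-vertsButLast (_ ∷ p) (u∉p ∷ _) (here refl) = All.lookup u∉p (last∈verts p)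
  ∉-vertsButLast (_ ∷ p) (_ ∷ p-path) (there z∈) = ∉-vertsButLast p p-path z∈

  interior-≢-ends : ∀ {u v z} (p : Walk G u v) → IsPath G p → z ∈ₗ interior G p → z ≢ u × z ≢ v
  interior-≢-ends (_ ∷ p) (u∉p ∷ p-path) z∈ =
    (λ z≡u → All.lookup u∉p (vertsButLast⊆verts p z∈) (sym z≡u)) , ∉-vertsButLast p p-path z∈

  suffix : ∀ {u w v} (q : Walk G w v) → IsPath G q → u ∈ₗ verts G q →
    Σ (Walk G u v) λ r → IsPath G r × verts G r ⊆ verts G q
  suffix [] q-path (here refl) = [] , q-path , id
  suffix (e ∷ q) q-path (here refl) = e ∷ q , q-path , id
  suffix (_ ∷ q) (_ ∷ q-path) (there u∈q) with r , r-path , r⊆q ← suffix q q-path u∈q =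
    r , r-path , there ∘ r⊆q

  -- Every walk contains a path between its ends (shortcut at the first repetition).
  walk→path : ∀ {u v} (p : Walk G u v) → Σ (Walk G u v) λ q → IsPath G q × verts G q ⊆ verts G p
  walk→path [] = [] , [] ∷ [] , id
  walk→path {u} (e ∷ p) with q , q-path , q⊆p ← walk→path p with u ∈? verts G q
  ... | yes u∈q = let r , r-path , r⊆q = suffix q q-path u∈q in r , r-path , there ∘ q⊆p ∘ r⊆q
  ... | no u∉q =
    e ∷ q , All.tabulate (λ z∈ u≡z → u∉q (subst (_∈ₗ verts G q) (sym u≡z) z∈)) ∷ q-path ,
    λ { (here refl) → here refl ; (there z∈) → there (q⊆p z∈) }

  path-length : ∀ {u v} (p : Walk G u v) → IsPath G p → length (verts G p) ≤ n
  path-length p p-path = subst (length (verts G p) ≤_) (LP.length-tabulate id)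
    (length-≤-⊆ p-path (λ {z} _ → ∈-allFin z))

  snoc : ∀ {u v w} → Walk G u v → adj G v w ≡ true → Walk G u w
  snoc [] e = e ∷ []
  snoc (e′ ∷ p) e = e′ ∷ snoc p e

  All-snoc : ∀ {P : Fin n → Set} {u v w} (p : Walk G u v) (e : adj G v w ≡ true) →
    All P (verts G p) → P w → All P (verts G (snoc p e))
  All-snoc [] e (pu ∷ []) pw = pu ∷ pw ∷ []
  All-snoc (_ ∷ p) e (pu ∷ ps) pw = pu ∷ All-snoc p e ps pw

-- Reaching within n steps
-- is decidable, and since paths have fewer than n steps it already captures
-- everything reachable: the component of a in the subgraph induced by P.
module Reachability {n : ℕ} (G : Graph n) {P : Fin n → Set} (P? : Decidable P) where

  open Walks G

  Reach≤ : ℕ → Fin n → Fin n → Set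
  Reach≤ zero a v = a ≡ v
  Reach≤ (suc t) a v = a ≡ v ⊎ ∃[ w ] P w × adj G a w ≡ true × Reach≤ t w v

  reach? : ∀ t a v → Dec (Reach≤ t a v)
  reach? zero a v = a FP.≟ v
  reach? (suc t) a v =
    (a FP.≟ v) ⊎-dec FP.any? (λ w → P? w ×-dec (adj G a w Bool.≟ true) ×-dec reach? t w v)

  reach-refl : ∀ t {a} → Reach≤ t a a
  reach-refl zero = refl
  reach-refl (suc t) = inj₁ refl

  reach→walk : ∀ t {a v} → Reach≤ t a v → P a → Σ (Walk G a v) λ p → All P (verts G p)
  reach→walk zero refl pa = [] , pa ∷ []
  reach→walk (suc t) (inj₁ refl) pa = [] , pa ∷ []
  reach→walk (suc t) (inj₂ (w , pw , e , r)) pa with p , p⊆P ← reach→walk t r pw = e ∷ p , pa ∷ p⊆P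

  walk→reach : ∀ t {a v} (p : Walk G a v) → All P (verts G p) →
    length (verts G p) ≤ suc t → Reach≤ t a v
  walk→reach t [] _ _ = reach-refl t
  walk→reach zero (_ ∷ []) _ (s≤s ())
  walk→reach zero (_ ∷ _ ∷ _) _ (s≤s ())
  walk→reach (suc t) (_∷_ {w = w} e p) (_ ∷ p⊆P) (s≤s ≤t) =
    inj₂ (w , All.lookup p⊆P (first∈verts p) , e , walk→reach t p p⊆P ≤t)

  Component : Fin n → Fin n → Set
  Component = Reach≤ n

  component? : ∀ a v → Dec (Component a v)
  component? = reach? n

  component-path : ∀ {a v} → Component a v → P a → Σ (Walk G a v) λ p → IsPath G p × All P (verts G p)
  component-path {a} c pa with p , p⊆P ← reach→walk n c pa with q , q-path , q⊆p ← walk→path p =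
    q , q-path , All.tabulate (All.lookup p⊆P ∘ q⊆p)

  component-⊆-P : ∀ {a v} → Component a v → P a → P v
  component-⊆-P c pa with p , _ , p⊆P ← component-path c pa = All.lookup p⊆P (last∈verts p)

  component-closed : ∀ {a v w} → Component a v → P a → P w → adj G v w ≡ true → Component a w
  component-closed {a} c pa pw e
    with p , p⊆P ← reach→walk n c pa
    with q , q-path , q⊆p ← walk→path (snoc p e) =
    walk→reach n q (All.tabulate (All.lookup (All-snoc p e p⊆P pw) ∘ q⊆p))
      (ℕP.m≤n⇒m≤1+n (path-length q q-path))

from-does : ∀ {A : Set} (a? : Dec A) → does a? ≡ true → A
from-does (yes a) _ = a

module Quotient {m n : ℕ} (G : Graph n) (φ : Fin n → Fin m) where

  Joined : Fin m → Fin m → Set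
  Joined i j = ∃[ p ] ∃[ q ] φ p ≡ i × φ q ≡ j × adj G p q ≡ true

  joined? : ∀ i j → Dec (Joined i j)
  joined? i j = FP.any? λ p → FP.any? λ q →
    (φ p FP.≟ i) ×-dec (φ q FP.≟ j) ×-dec (adj G p q Bool.≟ true)

  QuotientEdge : Fin m → Fin m → Set
  QuotientEdge i j = i ≢ j × Joined i j

  quotient-edge? : ∀ i j → Dec (QuotientEdge i j)
  quotient-edge? i j = ¬? (i FP.≟ j) ×-dec joined? i j

  quotient : Graph m
  quotient = record
    { adj    = λ i j → does (quotient-edge? i j)
    ; sym    = λ i j → does-⇔ (mk⇔ flip-edge flip-edge) (quotient-edge? i j) (quotient-edge? j i)
    ; irrefl = λ i → dec-false (quotient-edge? i i) (λ (i≢i , _) → i≢i refl)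
    }
    where
    flip-edge : ∀ {i j} → QuotientEdge i j → QuotientEdge j i
    flip-edge (i≢j , p , q , φp , φq , adj-pq) = i≢j ∘ sym , q , p , φq , φp , trans (adj-sym G q p) adj-pq

  quotient-adj⁻ : ∀ i j → adj quotient i j ≡ true → QuotientEdge i j
  quotient-adj⁻ i j = from-does (quotient-edge? i j)

  quotient-adj⁺ : ∀ {i j} → i ≢ j → Joined i j → adj quotient i j ≡ true
  quotient-adj⁺ {i} {j} i≢j joined = dec-true (quotient-edge? i j) (i≢j , joined)

  quotient-minor : (∀ i → ∃[ v ] φ v ≡ i) →
    (∀ u v → φ u ≡ φ v → Σ (Walk G u v) λ p → All (λ w → φ w ≡ φ u) (verts G p)) →
    IsMinor quotient G
  quotient-minor onto fibre-connected = record
    { branch    = just ∘ φ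
    ; nonempty  = λ i → let v , φv≡i = onto i in v , cong just φv≡i
    ; connected = λ i u v φu φv →
        let p , p⊆fibre = fibre-connected u v (just-injective (trans φu (sym φv)))
        in p , All.map (λ φw≡φu → trans (cong just φw≡φu) φu) p⊆fibre
    ; edges     = λ i j e → let _ , p , q , φp , φq , adj-pq = quotient-adj⁻ i j e
                            in p , q , cong just φp , cong just φq , adj-pq
    }

  quotient-numEdges : numEdges quotient ≤ numEdges G
  quotient-numEdges = numEdges-≤-image quotient G φ (λ i j → proj₂ ∘ quotient-adj⁻ i j)

  pullback-proper : ∀ {t} (col : Fin m → Fin t) →
    (∀ i j → adj quotient i j ≡ true → col i ≢ col j) →
    ∀ u v → adj G u v ≡ true → φ u ≢ φ v → col (φ u) ≢ col (φ v)
  pullback-proper col proper u v adj-uv φu≢φv =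
    proper (φ u) (φ v) (quotient-adj⁺ φu≢φv (u , v , refl , refl , adj-uv))

module ColouringsOff {n : ℕ} (G : Graph n) (x : Fin n) where

  ProperOff : ∀ {t} → (Fin n → Fin t) → Set
  ProperOff c = ∀ u v → u ≢ x → v ≢ x → adj G u v ≡ true → c u ≢ c v

  extend : ∀ {t} (c : Fin n → Fin t) → ProperOff c → (γ : Fin t) →
    (∀ v → v ∈ nbhd G x → c v ≢ γ) → Colorable G t
  extend {t} c proper γ γ∉N = colour , colour-proper
    where
    colour : Fin n → Fin t
    colour v with v FP.≟ x
    ... | yes _ = γ
    ... | no _ = c v

    colour-proper : ∀ u v → adj G u v ≡ true → colour u ≢ colour v
    colour-proper u v adj-uv with u FP.≟ x | v FP.≟ x
    ... | yes refl | yes refl = λ _ → case trans (sym adj-uv) (irrefl G x) of λ ()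
    ... | yes refl | no _ = γ∉N v (∈-tabulate⁺ adj-uv) ∘ sym
    ... | no _ | yes refl = γ∉N u (∈-tabulate⁺ (trans (adj-sym G x u) adj-uv))
    ... | no u≢x | no v≢x = proper u v u≢x v≢x adj-uv

  every-colour-on-nbhd : ∀ {t} → ¬ Colorable G t → (c : Fin n → Fin t) → ProperOff c →
    ∀ γ → ∃[ v ] v ∈ nbhd G x × c v ≡ γ
  every-colour-on-nbhd uncolourable c proper γ
    with FP.any? (λ v → (v SubP.∈? nbhd G x) ×-dec (c v FP.≟ γ))
  ... | yes found = let v , v∈N , cv≡γ = found in v , v∈N , cv≡γ
  ... | no missing =
    ⊥-elim (uncolourable (extend c proper γ (λ v v∈N cv≡γ → missing (v , v∈N , cv≡γ))))

  module KempeChange {t} (c : Fin n → Fin t) (proper : ProperOff c)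
                     {α β : Fin t} (α≢β : α ≢ β) where

    Bicoloured : Fin n → Set
    Bicoloured v = v ≢ x × (c v ≡ α ⊎ c v ≡ β)

    bicoloured? : Decidable Bicoloured
    bicoloured? v = ¬? (v FP.≟ x) ×-dec (c v FP.≟ α ⊎-dec c v FP.≟ β)

    open Reachability G bicoloured? public using (Component; component?; component-path; component-⊆-P)
    open Reachability G bicoloured? using (component-closed; reach-refl)

    -- the transposition α ↔ β, as far as it matters on colours α and β
    exchange : Fin t → Fin t
    exchange γ with γ FP.≟ α
    ... | yes _ = β
    ... | no _ = α

    exchange-α : exchange α ≡ β
    exchange-α with α FP.≟ α
    ... | yes _ = refl
    ... | no α≢α = ⊥-elim (α≢α refl)

    exchange-into : ∀ γ → exchange γ ≡ α ⊎ exchange γ ≡ β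
    exchange-into γ with γ FP.≟ α
    ... | yes _ = inj₂ refl
    ... | no _ = inj₁ refl

    exchange-injective : ∀ {γ δ} → (γ ≡ α ⊎ γ ≡ β) → (δ ≡ α ⊎ δ ≡ β) →
      exchange γ ≡ exchange δ → γ ≡ δ
    exchange-injective {γ} {δ} γ∈ δ∈ with γ FP.≟ α | δ FP.≟ α | γ∈ | δ∈
    ... | yes γ≡α | yes δ≡α | _ | _ = λ _ → trans γ≡α (sym δ≡α)
    ... | yes _ | no _ | _ | _ = ⊥-elim ∘ α≢β ∘ sym
    ... | no _ | yes _ | _ | _ = ⊥-elim ∘ α≢β
    ... | no γ≢α | no _ | inj₁ γ≡α | _ = ⊥-elim (γ≢α γ≡α)
    ... | no _ | no δ≢α | _ | inj₁ δ≡α = ⊥-elim (δ≢α δ≡α)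
    ... | no _ | no _ | inj₂ γ≡β | inj₂ δ≡β = λ _ → trans γ≡β (sym δ≡β)

    module _ (a : Fin n) (a-bicoloured : Bicoloured a) where

      recoloured : Fin n → Fin t
      recoloured v with component? a v
      ... | yes _ = exchange (c v)
      ... | no _ = c v

      recoloured-start : recoloured a ≡ exchange (c a)
      recoloured-start with component? a a
      ... | yes _ = refl
      ... | no a∉ = ⊥-elim (a∉ (reach-refl _))

      recoloured-outside : ∀ {v} → ¬ Component a v → recoloured v ≡ c v
      recoloured-outside {v} v∉ with component? a v
      ... | yes v∈ = ⊥-elim (v∉ v∈)
      ... | no _ = refl

      boundary : ∀ u v → v ≢ x → adj G u v ≡ true → Component a u → ¬ Component a v →
        exchange (c u) ≢ c v
      boundary u v v≢x adj-uv u∈ v∉ same =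
        v∉ (component-closed u∈ a-bicoloured
              (v≢x , subst (λ γ → γ ≡ α ⊎ γ ≡ β) same (exchange-into (c u))) adj-uv)

      recoloured-proper : ProperOff recoloured
      recoloured-proper u v u≢x v≢x adj-uv with component? a u | component? a v
      ... | yes u∈ | yes v∈ = proper u v u≢x v≢x adj-uv ∘ exchange-injective
          (proj₂ (component-⊆-P u∈ a-bicoloured)) (proj₂ (component-⊆-P v∈ a-bicoloured))
      ... | yes u∈ | no v∉ = boundary u v v≢x adj-uv u∈ v∉
      ... | no u∉ | yes v∈ = boundary v u u≢x (trans (adj-sym G v u) adj-uv) v∈ u∉ ∘ sym
      ... | no _ | no _ = proper u v u≢x v≢x adj-uv

module CriticalNeighbourhood (d s n : ℕ) (G : Graph n) (critical : ContractionCritical (suc (suc d)) G)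
  (x : Fin n) (deg : degree G x ≡ suc (suc d) + s)
  (S : Subset n) (S⊆N : ∀ v → v ∈ S → v ∈ nbhd G x) (S-independent : Independent G S)
  (∣S∣ : ∣ S ∣ ≡ s + 2) where

  open ColouringsOff G x

  N : Subset n
  N = nbhd G x

  N∖S : Fin n → Set
  N∖S v = v ∈ N × v ∉ S

  x∉N : x ∉ N
  x∉N x∈N with () ← trans (sym (irrefl G x)) (∈-tabulate⁻ x∈N)

  x∉S : x ∉ S
  x∉S = x∉N ∘ S⊆N x

  N≢x : ∀ {v} → v ∈ N → v ≢ x
  N≢x v∈N refl = x∉N v∈N

  ∣N∖S∣ : ∣ N ∩ ∁ S ∣ ≡ d
  ∣N∖S∣ = ℕP.+-cancelˡ-≡ (s + 2) _ _ (begin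
    s + 2 + ∣ N ∩ ∁ S ∣      ≡⟨ cong (_+ ∣ N ∩ ∁ S ∣) ∣S∣ ⟨
    ∣ S ∣ + ∣ N ∩ ∁ S ∣      ≡⟨ ∣p∣≡∣q∣+∣p∖q∣ N S (S⊆N _) ⟨
    ∣ N ∣                    ≡⟨ deg ⟩
    suc (suc d) + s          ≡⟨ ℕP.+-comm (suc (suc d)) s ⟩
    s + (2 + d)              ≡⟨ ℕP.+-assoc s 2 d ⟨
    s + 2 + d                ∎)
    where open ≡-Reasoning

  -- Contracting S ∪ {x} to a single vertex.  `collapse` sends S to x and fixes
  -- every other vertex; the quotient's vertices are the positions in the list
  -- of vertices outside S.
  collapse : Fin n → Fin n
  collapse v with v SubP.∈? S
  ... | yes _ = x
  ... | no _ = v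

  collapse-cases : ∀ v → (v ∈ S × collapse v ≡ x) ⊎ (v ∉ S × collapse v ≡ v)
  collapse-cases v with v SubP.∈? S
  ... | yes v∈S = inj₁ (v∈S , refl)
  ... | no v∉S = inj₂ (v∉S , refl)

  collapse-∈ : ∀ {v} → v ∈ S → collapse v ≡ x
  collapse-∈ {v} v∈S with collapse-cases v
  ... | inj₁ (_ , e) = e
  ... | inj₂ (v∉S , _) = ⊥-elim (v∉S v∈S)

  collapse-x : collapse x ≡ x
  collapse-x with collapse-cases x
  ... | inj₁ (x∈S , _) = ⊥-elim (x∉S x∈S)
  ... | inj₂ (_ , e) = e

  collapse-∉S : ∀ v → collapse v ∉ S
  collapse-∉S v with collapse-cases v
  ... | inj₁ (_ , e) = subst (_∉ S) (sym e) x∉S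
  ... | inj₂ (v∉S , e) = subst (_∉ S) (sym e) v∉S

  outsideS : List (Fin n)
  outsideS = elements (∁ S)

  φ : Fin n → Fin (length outsideS)
  φ v = index (∈-elements⁺ (SubP.x∉p⇒x∈∁p (collapse-∉S v)))

  lookup-φ : ∀ v → lookup outsideS (φ v) ≡ collapse v
  lookup-φ v = sym (lookup-index (∈-elements⁺ (SubP.x∉p⇒x∈∁p (collapse-∉S v))))

  φ-cong : ∀ {u v} → collapse u ≡ collapse v → φ u ≡ φ v
  φ-cong {u} {v} e = lookup-injective (elements-unique (∁ S)) (φ u) (φ v)
    (trans (lookup-φ u) (trans e (sym (lookup-φ v))))

  φ-collapse : ∀ {u v} → φ u ≡ φ v → collapse u ≡ collapse v
  φ-collapse {u} {v} e = trans (sym (lookup-φ u)) (trans (cong (lookup outsideS) e) (lookup-φ v))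

  φ-onto : ∀ i → ∃[ v ] φ v ≡ i
  φ-onto i = lookup outsideS i , lookup-injective (elements-unique (∁ S)) _ i
    (trans (lookup-φ (lookup outsideS i)) fixed)
    where
    fixed : collapse (lookup outsideS i) ≡ lookup outsideS i
    fixed with collapse-cases (lookup outsideS i)
    ... | inj₁ (∈S , _) = ⊥-elim (SubP.x∈∁p⇒x∉p (∈-elements⁻ (∈-lookup i)) ∈S)
    ... | inj₂ (_ , e) = e

  x-S : ∀ {v} → v ∈ S → adj G x v ≡ true
  x-S v∈S = ∈-tabulate⁻ (S⊆N _ v∈S)

  S-x : ∀ {v} → v ∈ S → adj G v x ≡ true
  S-x {v} v∈S = trans (adj-sym G v x) (x-S v∈S)

  -- Each fibre of φ is a single vertex or the star S ∪ {x}, hence connected.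
  fibre-connected : ∀ u v → φ u ≡ φ v → Σ (Walk G u v) λ p → All (λ w → φ w ≡ φ u) (verts G p)
  fibre-connected u v φu≡φv = connect (collapse-cases u) (collapse-cases v)
    where
    same : collapse u ≡ collapse v
    same = φ-collapse {u} {v} φu≡φv

    connect : (u ∈ S × collapse u ≡ x) ⊎ (u ∉ S × collapse u ≡ u) →
              (v ∈ S × collapse v ≡ x) ⊎ (v ∉ S × collapse v ≡ v) →
              Σ (Walk G u v) λ p → All (λ w → φ w ≡ φ u) (verts G p)
    connect (inj₁ (u∈S , cu)) (inj₁ (v∈S , _)) =
      S-x u∈S ∷ x-S v∈S ∷ [] , refl ∷ φ-cong {x} {u} (trans collapse-x (sym cu)) ∷ sym φu≡φv ∷ []
    connect (inj₁ (u∈S , cu)) (inj₂ (_ , cv)) with refl ← trans (sym cu) (trans same cv) =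
      S-x u∈S ∷ [] , refl ∷ sym φu≡φv ∷ []
    connect (inj₂ (_ , cu)) (inj₁ (v∈S , cv)) with refl ← trans (sym cu) (trans same cv) =
      x-S v∈S ∷ [] , refl ∷ sym φu≡φv ∷ []
    connect (inj₂ (_ , cu)) (inj₂ (_ , cv)) with refl ← trans (sym cu) (trans same cv) =
      [] , refl ∷ []

  module Q = Quotient G φ

  -- Contracting S ∪ {x} removes |S| ≥ 1 vertices and no edges are created.
  contraction-proper : IsProperMinor Q.quotient G
  contraction-proper =
    Q.quotient-minor φ-onto fibre-connected , ℕP.+-mono-<-≤ fewer-vertices Q.quotient-numEdges
    where
    fewer-vertices : length outsideS < n
    fewer-vertices = subst (_< n) (sym (trans (length-elements (∁ S)) (SubP.∣∁p∣≡n∸∣p∣ S)))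
      (ℕP.∸-monoʳ-< (subst (0 <_) (sym ∣S∣) (subst (0 <_) (ℕP.+-comm 2 s) (s≤s z≤n)))
                    (SubP.∣p∣≤n S))

  different-fibres : ∀ u v → u ≢ x → v ≢ x → adj G u v ≡ true → φ u ≢ φ v
  different-fibres u v u≢x v≢x adj-uv φu≡φv with collapse-cases u | collapse-cases v
  ... | inj₁ (u∈S , _) | inj₁ (v∈S , _) = case trans (sym adj-uv) (S-independent u v u∈S v∈S) of λ ()
  ... | inj₁ (_ , cu) | inj₂ (_ , cv) = v≢x (trans (sym cv) (trans (sym (φ-collapse {u} {v} φu≡φv)) cu))
  ... | inj₂ (_ , cu) | inj₁ (_ , cv) = u≢x (trans (sym cu) (trans (φ-collapse {u} {v} φu≡φv) cv))
  ... | inj₂ (_ , cu) | inj₂ (_ , cv) with refl ← trans (sym cu) (trans (φ-collapse {u} {v} φu≡φv) cv) =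
    case trans (sym adj-uv) (irrefl G u) of λ ()

  quotient-colouring : Colorable Q.quotient (suc d)
  quotient-colouring = proj₂ critical _ Q.quotient contraction-proper

  -- c is kept opaque: only the two properties below are used later.
  opaque
    c : Fin n → Fin (suc d)
    c = proj₁ quotient-colouring ∘ φ

    c-proper : ProperOff c
    c-proper u v u≢x v≢x adj-uv =
      Q.pullback-proper (proj₁ quotient-colouring) (proj₂ quotient-colouring) u v adj-uv
        (different-fibres u v u≢x v≢x adj-uv)

    c-on-S : ∀ v → v ∈ S → c v ≡ c x
    c-on-S v v∈S =
      cong (proj₁ quotient-colouring) (φ-cong {v} {x} (trans (collapse-∈ v∈S) (sym collapse-x)))

  ∈-elements-N∖S : ∀ {w} → N∖S w → w ∈ₗ elements (N ∩ ∁ S)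
  ∈-elements-N∖S (w∈N , w∉S) = ∈-elements⁺ (SubP.x∈p∩q⁺ (w∈N , SubP.x∉p⇒x∈∁p w∉S))

  -- Rainbow lemma: a proper (d+1)-colouring of G - x that is constant on S
  -- gives the d vertices of N(x) ∖ S distinct colours, all different from the
  -- colour of S.  Otherwise, if u ∈ N(x) ∖ S repeats a colour, the colour of S
  -- together with those of N(x) ∖ S ∖ {u} (at most d colours) cover N(x), and
  -- a colour left free could be given to x.
  rainbow : (c′ : Fin n → Fin (suc d)) → ProperOff c′ →
    (σ : Fin (suc d)) → (∀ v → v ∈ S → c′ v ≡ σ) →
    ∀ {u v} → N∖S u → v ∈ N → u ≢ v → c′ u ≢ c′ v
  rainbow c′ proper σ on-S {u} {v} u∈N∖S v∈N u≢v same = ℕP.<-irrefl refl (begin-strict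
    suc d                         ≡⟨ LP.length-tabulate id ⟨
    length (L.allFin (suc d))     ≤⟨ length-≤-⊆ (UniqueP.allFin⁺ (suc d)) (λ {γ} _ → covered γ) ⟩
    length palette                ≡⟨ cong suc (LP.length-map c′ others) ⟩
    suc (length others)           ≤⟨ fewer-others ⟩
    length (elements (N ∩ ∁ S))   ≡⟨ length-elements (N ∩ ∁ S) ⟩
    ∣ N ∩ ∁ S ∣                   ≡⟨ ∣N∖S∣ ⟩
    d                             <⟨ ℕP.n<1+n d ⟩
    suc d                         ∎)
    where
    open ℕP.≤-Reasoning
    not-u? : (w : Fin n) → Dec (w ≢ u)
    not-u? w = ¬? (w FP.≟ u)

    others : List (Fin n)
    others = L.filter not-u? (elements (N ∩ ∁ S))

    palette : List (Fin (suc d))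
    palette = σ ∷ map c′ others

    fewer-others : length others < length (elements (N ∩ ∁ S))
    fewer-others =
      LP.filter-notAll not-u? _ (Any.map (λ { refl u≢u → u≢u refl }) (∈-elements-N∖S u∈N∖S))

    other-colour : ∀ {w} → N∖S w → w ≢ u → c′ w ∈ₗ palette
    other-colour w∈N∖S w≢u = there (∈-map⁺ c′ (∈-filter⁺ not-u? (∈-elements-N∖S w∈N∖S) w≢u))

    colour-of-N : ∀ {w} → w ∈ N → c′ w ∈ₗ palette
    colour-of-N {w} w∈N with w SubP.∈? S | w FP.≟ u
    ... | yes w∈S | _ = here (on-S w w∈S)
    ... | no w∉S | no w≢u = other-colour (w∈N , w∉S) w≢u
    ... | no w∉S | yes refl with v SubP.∈? S
    ...   | yes v∈S = here (trans same (on-S v v∈S))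
    ...   | no v∉S = subst (_∈ₗ palette) (sym same) (other-colour (v∈N , v∉S) (u≢v ∘ sym))

    covered : ∀ γ → γ ∈ₗ palette
    covered γ with w , w∈N , c′w≡γ ← every-colour-on-nbhd (proj₂ (proj₁ critical)) c′ proper γ =
      subst (_∈ₗ palette) c′w≡γ (colour-of-N w∈N)

  distinct-colours : ∀ {u v} → N∖S u → v ∈ N → u ≢ v → c u ≢ c v
  distinct-colours = rainbow c c-proper (c x) c-on-S

  KempeVertex : Fin n → Fin n → Fin n → Set
  KempeVertex a b w = w ≢ x × (c w ≡ c a ⊎ c w ≡ c b)

  -- Kempe chains join N(x) ∖ S: for distinct a, b ∈ N(x) ∖ S the component of
  -- a in the (c a , c b)-coloured subgraph of G - x contains b.  Otherwise
  -- exchanging the two colours on it leaves S untouched (its colour is neither)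
  -- and gives a and b the same colour, contradicting the rainbow lemma.
  kempe-path : ∀ {a b} → N∖S a → N∖S b → a ≢ b →
    Σ (Walk G a b) λ p → IsPath G p × All (KempeVertex a b) (verts G p)
  kempe-path {a} {b} a∈N∖S b∈N∖S a≢b = chain (component? a b)
    where
    open KempeChange c c-proper (distinct-colours a∈N∖S (proj₁ b∈N∖S) a≢b)

    a-bicoloured : Bicoloured a
    a-bicoloured = N≢x (proj₁ a∈N∖S) , inj₁ refl

    c′ : Fin n → Fin (suc d)
    c′ = recoloured a a-bicoloured

    S-outside : ∀ {t} → t ∈ S → ¬ Component a t
    S-outside {t} t∈S t∈K with proj₂ (component-⊆-P t∈K a-bicoloured)
    ... | inj₁ ct≡ca =
      distinct-colours a∈N∖S (S⊆N t t∈S) (λ { refl → proj₂ a∈N∖S t∈S }) (sym ct≡ca)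
    ... | inj₂ ct≡cb =
      distinct-colours b∈N∖S (S⊆N t t∈S) (λ { refl → proj₂ b∈N∖S t∈S }) (sym ct≡cb)

    c′-on-S : ∀ t → t ∈ S → c′ t ≡ c x
    c′-on-S t t∈S = trans (recoloured-outside a a-bicoloured (S-outside t∈S)) (c-on-S t t∈S)

    chain : Dec (Component a b) → Σ (Walk G a b) λ p → IsPath G p × All Bicoloured (verts G p)
    chain (yes b∈K) = component-path b∈K a-bicoloured
    chain (no b∉K) = ⊥-elim (rainbow c′ (recoloured-proper a a-bicoloured) (c x) c′-on-S
      a∈N∖S (proj₁ b∈N∖S) a≢b (begin
        c′ a             ≡⟨ recoloured-start a a-bicoloured ⟩
        exchange (c a)   ≡⟨ exchange-α ⟩
        c b              ≡⟨ recoloured-outside a a-bicoloured b∉K ⟨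
        c′ b             ∎))
      where open ≡-Reasoning

  -- A path of Kempe vertices between a and b has its interior outside N[x]:
  -- an interior vertex in N(x) would repeat the colour of a or of b.
  kempe-interior : ∀ {a b} → N∖S a → N∖S b → (p : Walk G a b) → IsPath G p →
    All (KempeVertex a b) (verts G p) → All (λ w → w ≢ x × w ∉ N) (interior G p)
  kempe-interior a∈N∖S b∈N∖S p p-path p-kempe = All.tabulate λ {w} w∈ →
    let w≢x , colour = All.lookup p-kempe (interior⊆verts p w∈)
        w≢a , w≢b = interior-≢-ends p p-path w∈
    in w≢x , λ w∈N → case colour of λ where
      (inj₁ cw≡ca) → distinct-colours a∈N∖S w∈N (w≢a ∘ sym) (sym cw≡ca)
      (inj₂ cw≡cb) → distinct-colours b∈N∖S w∈N (w≢b ∘ sym) (sym cw≡cb)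
    where open Walks G

  -- Kempe vertices for two disjoint pairs of N(x) ∖ S are different, as the
  -- four colours involved are distinct.
  kempe-disjoint : ∀ {a b a′ b′} → N∖S a → N∖S b → N∖S a′ → N∖S b′ →
    a ≢ a′ → a ≢ b′ → b ≢ a′ → b ≢ b′ → ∀ {w} → KempeVertex a b w → ¬ KempeVertex a′ b′ w
  kempe-disjoint a∈ b∈ a′∈ b′∈ a≢a′ a≢b′ b≢a′ b≢b′ (_ , colour) (_ , colour′)
    with colour | colour′
  ... | inj₁ e | inj₁ e′ = distinct-colours a∈ (proj₁ a′∈) a≢a′ (trans (sym e) e′)
  ... | inj₁ e | inj₂ e′ = distinct-colours a∈ (proj₁ b′∈) a≢b′ (trans (sym e) e′)
  ... | inj₂ e | inj₁ e′ = distinct-colours b∈ (proj₁ a′∈) b≢a′ (trans (sym e) e′)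
  ... | inj₂ e | inj₂ e′ = distinct-colours b∈ (proj₁ b′∈) b≢b′ (trans (sym e) e′)

-- The argument does not need α(N(x)) = s + 2, the non-adjacent pair outside
-- S, the bounds on m, r and Σ r_i + m, nor the non-adjacency of a_i and b_ij.
lemma1p7 : (k s n : ℕ) → 4 ≤ k → (G : Graph n) → ContractionCritical k G →
    (x : Fin n) → degree G x ≡ k + s → IndepNumberNbhd G x (s + 2) →
    (S : Subset n) → (∀ v → v ∈ S → v ∈ nbhd G x) → Independent G S → ∣ S ∣ ≡ s + 2 →
    (∃[ u ] ∃[ v ] u ∈ nbhd G x × u ∉ S × v ∈ nbhd G x × v ∉ S × u ≢ v × adj G u v ≡ false) →
    (m : ℕ) → 1 ≤ m → (r : Fin m → ℕ) → (∀ i → 1 ≤ r i) →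
    sum (tabulate r) + m ≤ k ∸ 2 →
    (a : Fin m → Fin n) → (b : (i : Fin m) → Fin (r i) → Fin n) →
    (∀ i → a i ∈ nbhd G x × a i ∉ S) →
    (∀ i j → b i j ∈ nbhd G x × b i j ∉ S) →
    (∀ i i' → a i ≡ a i' → i ≡ i') →
    (∀ i j i' j' → b i j ≡ b i' j' →
      _≡_ {A = Σ (Fin m) (λ i → Fin (r i))} (i , j) (i' , j')) →
    (∀ i i' j' → a i ≢ b i' j') →
    (∀ i j → adj G (a i) (b i j) ≡ false) →
    Σ ((i : Fin m) → (j : Fin (r i)) → Walk G (a i) (b i j)) λ P →
      (∀ i j → IsPath G (P i j)) ×
      (∀ i j → All (λ w → w ≢ x × w ∉ nbhd G x) (interior G (P i j))) ×
      (∀ i j i' j' → i ≢ i' →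
        All (λ w → ¬ Any (w ≡_) (verts G (P i' j'))) (verts G (P i j)))
lemma1p7 (suc (suc d)) s n (s≤s (s≤s _)) G critical x deg _ S S⊆N S-independent ∣S∣ _ m _ r _ _
  a b a∈N∖S b∈N∖S a-injective b-injective a≢b _ =
  P , (λ i j → proj₁ (proj₂ (chain i j))) , interior-outside , disjoint
  where
  open CriticalNeighbourhood d s n G critical x deg S S⊆N S-independent ∣S∣

  chain : ∀ i j → Σ (Walk G (a i) (b i j)) λ p → IsPath G p × All (KempeVertex (a i) (b i j)) (verts G p)
  chain i j = kempe-path (a∈N∖S i) (b∈N∖S i j) (a≢b i i j)

  P : (i : Fin m) → (j : Fin (r i)) → Walk G (a i) (b i j)
  P i j = proj₁ (chain i j)

  interior-outside : ∀ i j → All (λ w → w ≢ x × w ∉ nbhd G x) (interior G (P i j))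
  interior-outside i j = let _ , is-path , kempe-vertices = chain i j in
    kempe-interior (a∈N∖S i) (b∈N∖S i j) (P i j) is-path kempe-vertices

  disjoint : ∀ i j i′ j′ → i ≢ i′ → All (λ w → ¬ Any (w ≡_) (verts G (P i′ j′))) (verts G (P i j))
  disjoint i j i′ j′ i≢i′ = All.tabulate λ w∈ w∈′ →
    kempe-disjoint (a∈N∖S i) (b∈N∖S i j) (a∈N∖S i′) (b∈N∖S i′ j′)
      (i≢i′ ∘ a-injective i i′) (a≢b i i′ j′) (a≢b i′ i j ∘ sym)
      (i≢i′ ∘ cong proj₁ ∘ b-injective i j i′ j′)
      (All.lookup (proj₂ (proj₂ (chain i j))) w∈) (All.lookup (proj₂ (proj₂ (chain i′ j′))) w∈′)
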